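{- Let $k\ge 2$, $s\ge 1$ and $c$ be integers with $0\le c\le s-1$, and let $n$ be an integer with $n\ge c+k(s-c)$. For $i=1,\ldots,k$ let ${\cal A}_i\subset\binom{[n]}{s}$, and suppose that $\{{\cal A}_i\}_{i=1}^k$ contains no multicolor sunflower with $k$ petals and core size $c$. Then $$\sum_{i=1}^k|{\cal A}_i|\le (k-1)\binom{n}{s}.$$ Moreover, this bound is tight: there exist such families attaining equality.
   Context: $[n]=\{1,\ldots,n\}$ and $\binom{[n]}{s}$ is the family of all $s$-element subsets of $[n]$. Given families ${\cal A}_1,\ldots,{\cal A}_k$ of subsets of $[n]$, a multicolor sunflower with $k$ petals is a choice of sets $A_i\in{\cal A}_i$, $i=1,\ldots,k$, together with a set $C$ (the core) such that $A_i\cap A_j=C$ for all $i\neq j$ and $A_i\setminus C\neq\emptyset$ for all $i$; its core size is $|C|$. -}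

module Defs where

open import Data.Nat using (ℕ; _+_; _*_; _∸_; _≤_)
open import Data.Nat.Combinatorics using (_C_)
open import Data.Fin using (Fin)
open import Data.Fin.Subset using (Subset; _∩_; _─_; ∣_∣; Nonempty)
open import Data.List using (List; length; tabulate)
open import Data.Nat.ListAction using (sum)
open import Data.List.Relation.Unary.All using (All)
open import Data.List.Relation.Unary.Unique.Propositional using (Unique)
open import Data.List.Membership.Propositional using (_∈_)
open import Data.Product using (Σ; _×_)
open import Relation.Binary.PropositionalEquality using (_≡_)
open import Relation.Nullary using (¬_)

record Family (n s : ℕ) : Set where
  field
    members : List (Subset n)
    distinct : Unique members
    uniform : All (λ A → ∣ A ∣ ≡ s) members

open Family public

size : ∀ {n s} → Family n s → ℕ
size 𝒜 = length (members 𝒜)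

totalSize : ∀ {k n s} → (Fin k → Family n s) → ℕ
totalSize 𝒜 = sum (tabulate (λ i → size (𝒜 i)))

record MulticolorSunflower {k n s : ℕ} (𝒜 : Fin k → Family n s) (c : ℕ) : Set where
  field
    petal : Fin k → Subset n
    petal∈ : ∀ i → petal i ∈ members (𝒜 i)
    core : Subset n
    pairwise : ∀ i j → ¬ (i ≡ j) → petal i ∩ petal j ≡ core
    nonempty : ∀ i → Nonempty (petal i ─ core)
    coreSize : ∣ core ∣ ≡ c

SunflowerFree : ∀ {k n s} → (Fin k → Family n s) → ℕ → Set
SunflowerFree 𝒜 c = ¬ MulticolorSunflower 𝒜 c

-- Double counting. A configuration labels each point of [n] as core, as private to petal i
-- (i < k) or as blank, using c core labels and s − c labels of each petal; the sets
-- P_i = core ∪ (private points of i) then form a sunflower with k petals and core size c.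
-- If the families are sunflower-free, at most k − 1 of the P_i lie in their families, so
-- summing over the list V of all configurations, Σ_i Σ_{S ∈ 𝒜_i} deg_i S ≤ (k − 1) |V|, where
-- deg_i S is the number of configurations with P_i = S. Computed point by point, deg_i S is a
-- binomial coefficient times a multinomial count that is symmetric in the petal labels, so it
-- is one constant D for every i and every s-set S, and D > 0 precisely because
-- n ≥ c + k(s − c). The same identity for the complete family gives |V| = C(n, s) D.
-- Equality is attained by an empty first family and complete other families.

module Submission where

open import Defs
open import Data.Bool.Base using (Bool; true; false; _∧_; if_then_else_)
import Data.Bool.Properties as Bool
open import Data.Nat.Base using (ℕ; zero; suc; pred; _+_; _*_; _∸_; _≤_; _<_; z≤n; s≤s; >-nonZero; ≢-nonZero)
open import Data.Nat.Properties
  using ( +-*-semiring; +-commutativeSemigroup; module ≤-Reasoning; _≤?_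
        ; +-assoc; +-comm; +-identityʳ; +-suc; +-cancelˡ-≡; +-mono-≤; m+n≡0⇒m≡0; m+n≡0⇒n≡0
        ; *-assoc; *-comm; *-identityʳ; *-zeroʳ; *-distribˡ-+; *-distribʳ-+; *-cancelʳ-≤; *-mono-<
        ; ≤-reflexive; ≤-trans; ≤-antisym; ≤-pred; <⇒≤; <-≤-trans; >⇒≢; ≰⇒>; n≤0⇒n≡0; n<1⇒n≡0
        ; m≤m+n; m≤n+m; m+[n∸m]≡n; m+n≤o⇒m≤o∸n; m<n⇒0<n∸m; suc-injective; suc-pred )
  renaming (_≟_ to _≟ℕ_)
open import Algebra.Properties.CommutativeSemigroup +-commutativeSemigroup using (interchange; x∙yz≈y∙xz)
open import Data.Nat.Combinatorics using (_C_; nCk+nC[k+1]≡[n+1]C[k+1])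
open import Data.Nat.ListAction using (sum)
open import Algebra.Properties.Semiring.Sum +-*-semiring
  using (sum-cong-≗; sum-replicate-zero; sum-remove; sum-permute; ∑-distrib-+; *-distribˡ-sum; *-distribʳ-sum)
  renaming (sum to ∑)
open import Data.Fin.Base using (Fin; zero; suc; punchIn)
open import Data.Fin.Properties using (_≟_; punchInᵢ≢i; all?; ¬∀⟶∃¬)
open import Data.Fin.Permutation using (Permutation; _⟨$⟩ʳ_; _⟨$⟩ˡ_; inverseˡ; transpose)
import Data.Fin.Permutation.Components as PermutationComponents
open import Data.Fin.Subset using (Subset; inside; outside; ∣_∣; ∁; _∩_; _─_; Nonempty)
open import Data.Fin.Subset.Properties using (∣∁p∣≡n∸∣p∣)
open import Data.Vec.Base as Vec using (Vec; []; _∷_; here; there)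
open import Data.Vec.Properties using (≡-dec; ∷-injectiveʳ)
open import Data.Vec.Functional using (updateAt)
open import Data.Vec.Functional.Properties
  using (updateAt-updates; updateAt-minimal; updateAt-commutes; updateAt-updateAt)
open import Data.List.Base using (List; []; _∷_; [_]; _++_; map; concat; tabulate; replicate; length)
open import Data.List.Properties using (length-++; length-map)
open import Data.List.Relation.Unary.All using (All; []; _∷_)
import Data.List.Relation.Unary.All as All
import Data.List.Relation.Unary.All.Properties as All
open import Data.List.Relation.Unary.AllPairs using ([]; _∷_)
open import Data.List.Relation.Unary.Unique.Propositional using (Unique)
import Data.List.Relation.Unary.Unique.Propositional.Properties as Unique
open import Data.List.Membership.Propositional using (_∈_)
open import Data.List.Membership.Propositional.Properties using (∈-map⁺; ∈-map⁻; ∈-++⁺ˡ; ∈-++⁺ʳ)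
open import Data.List.Relation.Unary.Any using (here; there)
open import Data.Product using (Σ; _×_; _,_)
open import Function.Base using (_∘_; const)
open import Relation.Binary.Definitions using (DecidableEquality)
open import Relation.Binary.PropositionalEquality
  using (_≡_; _≢_; refl; sym; trans; cong; cong₂; subst; _≗_; module ≡-Reasoning)
open import Relation.Nullary using (¬_; yes; no; does; contradiction)
open import Relation.Nullary.Decidable using (dec-true)

variable
  A B : Set
  k n : ℕ

sumOver : List A → (A → ℕ) → ℕ
sumOver []       f = 0
sumOver (x ∷ xs) f = f x + sumOver xs f

syntax sumOver xs (λ x → e) = ∑[ x ∈ xs ] e

sumOver-++ : ∀ xs ys (f : A → ℕ) → sumOver (xs ++ ys) f ≡ sumOver xs f + sumOver ys f
sumOver-++ []       ys f = refl
sumOver-++ (x ∷ xs) ys f = trans (cong (f x +_) (sumOver-++ xs ys f)) (sym (+-assoc (f x) _ _))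

sumOver-map : ∀ (g : A → B) xs (f : B → ℕ) → sumOver (map g xs) f ≡ sumOver xs (f ∘ g)
sumOver-map g []       f = refl
sumOver-map g (x ∷ xs) f = cong (f (g x) +_) (sumOver-map g xs f)

sumOver-concat-tabulate : ∀ (h : Fin k → List A) f →
  sumOver (concat (tabulate h)) f ≡ ∑ (λ j → sumOver (h j) f)
sumOver-concat-tabulate {zero}  h f = refl
sumOver-concat-tabulate {suc k} h f =
  trans (sumOver-++ (h zero) _ f) (cong (sumOver (h zero) f +_) (sumOver-concat-tabulate (h ∘ suc) f))

sumOver-replicate : ∀ m (x : A) f → sumOver (replicate m x) f ≡ m * f x
sumOver-replicate zero    x f = refl
sumOver-replicate (suc m) x f = cong (f x +_) (sumOver-replicate m x f)

sumOver-const : ∀ (xs : List A) a → ∑[ x ∈ xs ] a ≡ length xs * a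
sumOver-const []       a = refl
sumOver-const (x ∷ xs) a = cong (a +_) (sumOver-const xs a)

sumOver-zero : ∀ (xs : List A) → ∑[ x ∈ xs ] 0 ≡ 0
sumOver-zero xs = trans (sumOver-const xs 0) (*-zeroʳ (length xs))

module _ {P : A → Set} where

  sumOver-congᴬ : ∀ {xs f g} → All P xs → (∀ {x} → P x → f x ≡ g x) → sumOver xs f ≡ sumOver xs g
  sumOver-congᴬ []         f≡g = refl
  sumOver-congᴬ (px ∷ pxs) f≡g = cong₂ _+_ (f≡g px) (sumOver-congᴬ pxs f≡g)

  sumOver-monoᴬ : ∀ {xs f g} → All P xs → (∀ {x} → P x → f x ≤ g x) → sumOver xs f ≤ sumOver xs g
  sumOver-monoᴬ []         f≤g = z≤n
  sumOver-monoᴬ (px ∷ pxs) f≤g = +-mono-≤ (f≤g px) (sumOver-monoᴬ pxs f≤g)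

sumOver-+ : ∀ (xs : List A) f g → ∑[ x ∈ xs ] (f x + g x) ≡ sumOver xs f + sumOver xs g
sumOver-+ []       f g = refl
sumOver-+ (x ∷ xs) f g = trans (cong (f x + g x +_) (sumOver-+ xs f g))
                               (interchange (f x) (g x) _ _)

sumOver-comm : ∀ (xs : List A) (ys : List B) (g : A → B → ℕ) →
  ∑[ x ∈ xs ] ∑[ y ∈ ys ] g x y ≡ ∑[ y ∈ ys ] ∑[ x ∈ xs ] g x y
sumOver-comm []       ys g = sym (sumOver-zero ys)
sumOver-comm (x ∷ xs) ys g =
  trans (cong (sumOver ys (g x) +_) (sumOver-comm xs ys g)) (sym (sumOver-+ ys (g x) _))

sumOver-∑ : ∀ (xs : List A) (g : Fin k → A → ℕ) →
  ∑[ x ∈ xs ] ∑ (λ i → g i x) ≡ ∑ (λ i → sumOver xs (g i))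
sumOver-∑ {k = k} []       g = sym (sum-replicate-zero k)
sumOver-∑ (x ∷ xs) g =
  trans (cong (∑ (λ i → g i x) +_) (sumOver-∑ xs g)) (sym (∑-distrib-+ (λ i → g i x) _))

sum-tabulate : ∀ (f : Fin k → ℕ) → sum (tabulate f) ≡ ∑ f
sum-tabulate {zero}  f = refl
sum-tabulate {suc k} f = cong (f zero +_) (sum-tabulate (f ∘ suc))

∑-const : ∀ k a → ∑ {k} (const a) ≡ k * a
∑-const zero    a = refl
∑-const (suc k) a = cong (a +_) (∑-const k a)

∑-≤ : ∀ {b} (f : Fin k → ℕ) → (∀ i → f i ≤ b) → ∑ f ≤ k * b
∑-≤ {zero}  f f≤b = z≤n
∑-≤ {suc k} f f≤b = +-mono-≤ (f≤b zero) (∑-≤ (f ∘ suc) (f≤b ∘ suc))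

∑-term : ∀ (f : Fin k → ℕ) i → f i ≤ ∑ f
∑-term {suc k} f i = ≤-trans (m≤m+n (f i) _) (≤-reflexive (sym (sum-remove {i = i} f)))

∑-single : ∀ (f : Fin k → ℕ) i → (∀ j → j ≢ i → f j ≡ 0) → ∑ f ≡ f i
∑-single {suc k} f i f≡0 = begin
  ∑ f                             ≡⟨ sum-remove {i = i} f ⟩
  f i + ∑ (f ∘ punchIn i)         ≡⟨ cong (f i +_) (sum-cong-≗ (λ j → f≡0 _ (punchInᵢ≢i i j))) ⟩
  f i + ∑ {k} (const 0)           ≡⟨ cong (f i +_) (sum-replicate-zero k) ⟩
  f i + 0                         ≡⟨ +-identityʳ (f i) ⟩
  f i                             ∎
  where open ≡-Reasoning

∑-≤-pred : ∀ (f : Fin (suc k) → ℕ) → (∀ i → f i ≤ 1) → ¬ (∀ i → 1 ≤ f i) → ∑ f ≤ k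
∑-≤-pred {k} f f≤1 ¬1≤f with ¬∀⟶∃¬ _ _ (λ i → 1 ≤? f i) ¬1≤f
... | i , f≱1 = begin
  ∑ f                      ≡⟨ sum-remove {i = i} f ⟩
  f i + ∑ (f ∘ punchIn i)  ≡⟨ cong (_+ ∑ (f ∘ punchIn i)) (n<1⇒n≡0 (≰⇒> f≱1)) ⟩
  ∑ (f ∘ punchIn i)        ≤⟨ ∑-≤ _ (f≤1 ∘ punchIn i) ⟩
  k * 1                    ≡⟨ *-identityʳ k ⟩
  k                        ∎
  where open ≤-Reasoning

onSuc : A → ℕ → (ℕ → A) → A
onSuc d zero    f = d
onSuc d (suc a) f = f a

onSuc-cong : ∀ (d : A) a {f g} → f ≗ g → onSuc d a f ≡ onSuc d a g
onSuc-cong d zero    f≗g = refl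
onSuc-cong d (suc a) f≗g = f≗g a

onSuc-const : ∀ (d : A) a → onSuc d a (const d) ≡ d
onSuc-const d zero    = refl
onSuc-const d (suc a) = refl

onSuc-natural : ∀ (g : A → B) {d d'} a f → g d ≡ d' → g (onSuc d a f) ≡ onSuc d' a (g ∘ f)
onSuc-natural g zero    f gd≡d' = gd≡d'
onSuc-natural g (suc a) f gd≡d' = refl

onSuc-elim : ∀ (P : A → Set) {d} a {f} → P d → (∀ x → a ≡ suc x → P (f x)) → P (onSuc d a f)
onSuc-elim P zero    Pd Pf = Pd
onSuc-elim P (suc a) Pd Pf = Pf a refl

_[_]≔_ : (Fin k → ℕ) → Fin k → ℕ → Fin k → ℕ
r [ j ]≔ x = updateAt r j (const x)

∑-updateAt : ∀ (r : Fin k → ℕ) i x → r i + ∑ (r [ i ]≔ x) ≡ x + ∑ r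
∑-updateAt {suc k} r i x = begin
  r i + ∑ r'                         ≡⟨ cong (r i +_) (sum-remove {i = i} r') ⟩
  r i + (r' i + ∑ (r' ∘ punchIn i))  ≡⟨ cong (λ a → r i + (a + ∑ (r' ∘ punchIn i))) (updateAt-updates i r) ⟩
  r i + (x + ∑ (r' ∘ punchIn i))     ≡⟨ cong (λ a → r i + (x + a)) (sum-cong-≗ untouched) ⟩
  r i + (x + ∑ (r ∘ punchIn i))      ≡⟨ x∙yz≈y∙xz (r i) x _ ⟩
  x + (r i + ∑ (r ∘ punchIn i))      ≡⟨ cong (x +_) (sum-remove {i = i} r) ⟨
  x + ∑ r                            ∎
  where
  open ≡-Reasoning
  r' = r [ i ]≔ x
  untouched : r' ∘ punchIn i ≗ r ∘ punchIn i
  untouched j = updateAt-minimal (punchIn i j) i r (punchInᵢ≢i i j)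

∑-decrement : ∀ (r : Fin k → ℕ) j {x} → r j ≡ suc x → suc (∑ (r [ j ]≔ x)) ≡ ∑ r
∑-decrement r j {x} rj≡1+x = +-cancelˡ-≡ x _ _ (begin
  x + suc (∑ (r [ j ]≔ x))  ≡⟨ +-suc x _ ⟩
  suc x + ∑ (r [ j ]≔ x)    ≡⟨ cong (_+ ∑ (r [ j ]≔ x)) rj≡1+x ⟨
  r j + ∑ (r [ j ]≔ x)      ≡⟨ ∑-updateAt r j x ⟩
  x + ∑ r                   ∎)
  where open ≡-Reasoning

≔-cong : ∀ {r r' : Fin k → ℕ} j x → r ≗ r' → r [ j ]≔ x ≗ r' [ j ]≔ x
≔-cong {r = r} {r'} j x r≗r' i with i ≟ j
... | yes refl = trans (updateAt-updates i r) (sym (updateAt-updates i r'))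
... | no i≢j   = trans (updateAt-minimal i j r i≢j) (trans (r≗r' i) (sym (updateAt-minimal i j r' i≢j)))

≔-rearrange : ∀ (π : Permutation k k) (r : Fin k → ℕ) j x →
  (r ∘ (π ⟨$⟩ʳ_)) [ j ]≔ x ≗ (r [ π ⟨$⟩ʳ j ]≔ x) ∘ (π ⟨$⟩ʳ_)
≔-rearrange π r j x i with i ≟ j
... | yes refl = trans (updateAt-updates i _) (sym (updateAt-updates (π ⟨$⟩ʳ i) r))
... | no i≢j   = trans (updateAt-minimal i j _ i≢j) (sym (updateAt-minimal _ _ r (i≢j ∘ injective)))
  where
  injective : ∀ {a b} → π ⟨$⟩ʳ a ≡ π ⟨$⟩ʳ b → a ≡ b
  injective {a} {b} πa≡πb = trans (sym (inverseˡ π)) (trans (cong (π ⟨$⟩ˡ_) πa≡πb) (inverseˡ π))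

-- Labelled configurations

data Label (k : ℕ) : Set where
  core  : Label k
  petal : Fin k → Label k
  blank : Label k

inPetal : Fin k → Label k → Bool
inPetal i core      = true
inPetal i (petal j) = does (i ≟ j)
inPetal i blank     = false

isCore : Label k → Bool
isCore core      = true
isCore (petal _) = false
isCore blank     = false

petalSet : Fin k → Vec (Label k) n → Subset n
petalSet i = Vec.map (inPetal i)

coreSet : Vec (Label k) n → Subset n
coreSet = Vec.map isCore

inPetal-∧ : ∀ {i j : Fin k} → i ≢ j → ∀ l → inPetal i l ∧ inPetal j l ≡ isCore l
inPetal-∧ i≢j core = refl
inPetal-∧ i≢j blank = refl
inPetal-∧ {i = i} {j} i≢j (petal p) with i ≟ p | j ≟ p
... | yes refl | yes refl = contradiction refl i≢j
... | yes _    | no _     = refl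
... | no _     | _        = refl

petalSet-∩ : ∀ {i j : Fin k} → i ≢ j → (v : Vec (Label k) n) → petalSet i v ∩ petalSet j v ≡ coreSet v
petalSet-∩ i≢j []      = refl
petalSet-∩ i≢j (l ∷ v) = cong₂ _∷_ (inPetal-∧ i≢j l) (petalSet-∩ i≢j v)

zeroIndicator : ℕ → ℕ
zeroIndicator zero    = 1
zeroIndicator (suc _) = 0

zeroIndicator-+ : ∀ a b → zeroIndicator (a + b) ≡ zeroIndicator a * zeroIndicator b
zeroIndicator-+ zero    b = sym (+-identityʳ _)
zeroIndicator-+ (suc a) b = refl

-- The labellings with exactly c core labels and r j labels petal j; all other points are blank.
configurations : ∀ n → ℕ → (Fin k → ℕ) → List (Vec (Label k) n)
configurations zero    c r = replicate (zeroIndicator (c + ∑ r)) []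
configurations (suc n) c r =
  map (blank ∷_) (configurations n c r) ++
  onSuc [] c (λ c' → map (core ∷_) (configurations n c' r)) ++
  concat (tabulate λ j → onSuc [] (r j) λ x → map (petal j ∷_) (configurations n c (r [ j ]≔ x)))

sumOver-configurations : ∀ n c (r : Fin k → ℕ) (g : Vec (Label k) (suc n) → ℕ) →
  sumOver (configurations (suc n) c r) g ≡
    ∑[ v ∈ configurations n c r ] g (blank ∷ v) +
    (onSuc 0 c (λ c' → ∑[ v ∈ configurations n c' r ] g (core ∷ v)) +
     ∑ (λ j → onSuc 0 (r j) λ x → ∑[ v ∈ configurations n c (r [ j ]≔ x) ] g (petal j ∷ v)))
sumOver-configurations n c r g = begin
  sumOver (blanks ++ cores ++ concat (tabulate petals)) g
    ≡⟨ sumOver-++ blanks _ g ⟩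
  sumOver blanks g + sumOver (cores ++ concat (tabulate petals)) g
    ≡⟨ cong₂ _+_ (sumOver-map (blank ∷_) (configurations n c r) g) (sumOver-++ cores _ g) ⟩
  ∑blanks + (sumOver cores g + sumOver (concat (tabulate petals)) g)
    ≡⟨ cong (λ a → ∑blanks + (sumOver cores g + a)) (sumOver-concat-tabulate petals g) ⟩
  ∑blanks + (sumOver cores g + ∑ (λ j → sumOver (petals j) g))
    ≡⟨ cong (∑blanks +_) (cong₂ _+_ (sumOver-onSuc-map c core (λ c' → configurations n c' r))
         (sum-cong-≗ λ j → sumOver-onSuc-map (r j) (petal j) (λ x → configurations n c (r [ j ]≔ x)))) ⟩
  ∑blanks + (onSuc 0 c (λ c' → ∑[ v ∈ configurations n c' r ] g (core ∷ v)) +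
     ∑ (λ j → onSuc 0 (r j) λ x → ∑[ v ∈ configurations n c (r [ j ]≔ x) ] g (petal j ∷ v))) ∎
  where
  open ≡-Reasoning
  blanks = map (blank ∷_) (configurations n c r)
  ∑blanks = ∑[ v ∈ configurations n c r ] g (blank ∷ v)
  cores = onSuc [] c (λ c' → map (core ∷_) (configurations n c' r))
  petals = λ j → onSuc [] (r j) λ x → map (petal j ∷_) (configurations n c (r [ j ]≔ x))
  sumOver-onSuc-map : ∀ a l (h : ℕ → List (Vec (Label _) n)) →
    sumOver (onSuc [] a (map (l ∷_) ∘ h)) g ≡ onSuc 0 a (λ x → ∑[ v ∈ h x ] g (l ∷ v))
  sumOver-onSuc-map a l h = trans (onSuc-natural (λ vs → sumOver vs g) a _ refl)
                                  (onSuc-cong 0 a (λ x → sumOver-map (l ∷_) (h x) g))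

record SunflowerShape (c : ℕ) (r : Fin k → ℕ) (v : Vec (Label k) n) : Set where
  field
    core-size  : ∣ coreSet v ∣ ≡ c
    petal-size : ∀ i → ∣ petalSet i v ∣ ≡ c + r i
    petal⊈core : ∀ i → 0 < r i → Nonempty (petalSet i v ─ coreSet v)

module _ {c : ℕ} {r : Fin k → ℕ} {v : Vec (Label k) n} (shape : SunflowerShape c r v) where
  open SunflowerShape shape

  blank∷-shape : SunflowerShape c r (blank ∷ v)
  blank∷-shape = record
    { core-size  = core-size
    ; petal-size = petal-size
    ; petal⊈core = λ i 0<ri → let x , x∈ = petal⊈core i 0<ri in suc x , there x∈
    }

  core∷-shape : SunflowerShape (suc c) r (core ∷ v)
  core∷-shape = record
    { core-size  = cong suc core-size
    ; petal-size = cong suc ∘ petal-size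
    ; petal⊈core = λ i 0<ri → let x , x∈ = petal⊈core i 0<ri in suc x , there x∈
    }

petal∷-shape : ∀ {c} {r : Fin k → ℕ} {v : Vec (Label k) n} j {x} → r j ≡ suc x →
  SunflowerShape c (r [ j ]≔ x) v → SunflowerShape c r (petal j ∷ v)
petal∷-shape {c = c} {r} {v} j {x} rj≡1+x shape = record
  { core-size  = core-size shape
  ; petal-size = petal-size′
  ; petal⊈core = petal⊈core′
  }
  where
  open SunflowerShape
  petal-size′ : ∀ i → ∣ petalSet i (petal j ∷ v) ∣ ≡ c + r i
  petal-size′ i with i ≟ j
  ... | yes refl = begin
    suc ∣ petalSet i v ∣      ≡⟨ cong suc (petal-size shape i) ⟩
    suc (c + (r [ i ]≔ x) i)  ≡⟨ cong (λ a → suc (c + a)) (updateAt-updates i r) ⟩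
    suc (c + x)               ≡⟨ +-suc c x ⟨
    c + suc x                 ≡⟨ cong (c +_) rj≡1+x ⟨
    c + r i                   ∎
    where open ≡-Reasoning
  ... | no i≢j = trans (petal-size shape i) (cong (c +_) (updateAt-minimal i j r i≢j))
  petal⊈core′ : ∀ i → 0 < r i → Nonempty (petalSet i (petal j ∷ v) ─ coreSet (petal j ∷ v))
  petal⊈core′ i 0<ri with i ≟ j
  ... | yes refl = zero , here
  ... | no i≢j   = let y , y∈ = petal⊈core shape i (subst (0 <_) (sym (updateAt-minimal i j r i≢j)) 0<ri)
                   in suc y , there y∈

configurations-shape : ∀ n c (r : Fin k → ℕ) → All (SunflowerShape c r) (configurations n c r)
configurations-shape zero c r with c + ∑ r in c+∑r≡0
... | suc _ = []
... | zero  = record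
  { core-size  = sym c≡0
  ; petal-size = λ i → sym (cong₂ _+_ c≡0 (r≡0 i))
  ; petal⊈core = λ i 0<ri → contradiction (r≡0 i) (>⇒≢ 0<ri)
  } ∷ []
  where
  c≡0 : c ≡ 0
  c≡0 = m+n≡0⇒m≡0 c c+∑r≡0
  r≡0 : ∀ i → r i ≡ 0
  r≡0 i = m+n≡0⇒m≡0 (r i) (trans (∑-updateAt r i 0) (m+n≡0⇒n≡0 c c+∑r≡0))
configurations-shape (suc n) c r =
  All.++⁺ (All.map⁺ (All.map blank∷-shape (configurations-shape n c r)))
  (All.++⁺ (onSuc-elim (All _) c [] λ { c' refl →
              All.map⁺ (All.map core∷-shape (configurations-shape n c' r)) })
           (All.concat⁺ (All.tabulate⁺ λ j → onSuc-elim (All _) (r j) [] λ x rj≡1+x →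
              All.map⁺ (All.map (petal∷-shape j rj≡1+x) (configurations-shape n c (r [ j ]≔ x))))))

-- Counting configurations with a given petal

-- The number of labellings of s points by exactly a core and b petal labels, and of t points by
-- exactly r j labels petal j and blanks.
twoColourings : ℕ → ℕ → ℕ → ℕ
twoColourings zero    a b = zeroIndicator (a + b)
twoColourings (suc s) a b = onSuc 0 a (λ a' → twoColourings s a' b) + onSuc 0 b (twoColourings s a)

placements : ℕ → (Fin k → ℕ) → ℕ
placements zero    r = zeroIndicator (∑ r)
placements (suc t) r = placements t r + ∑ (λ j → onSuc 0 (r j) λ x → placements t (r [ j ]≔ x))

placements-cong : ∀ t {r r' : Fin k → ℕ} → r ≗ r' → placements t r ≡ placements t r'
placements-cong zero    r≗r' = cong zeroIndicator (sum-cong-≗ r≗r')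
placements-cong (suc t) {r} {r'} r≗r' = cong₂ _+_ (placements-cong t r≗r') (sum-cong-≗ λ j →
  trans (onSuc-cong 0 (r j) λ x → placements-cong t (≔-cong j x r≗r'))
        (cong (λ a → onSuc 0 a λ x → placements t (r' [ j ]≔ x)) (r≗r' j)))

placements-rearrange : ∀ (π : Permutation k k) t r → placements t (r ∘ (π ⟨$⟩ʳ_)) ≡ placements t r
placements-rearrange π zero    r = cong zeroIndicator (sym (sum-permute r π))
placements-rearrange π (suc t) r = cong₂ _+_ (placements-rearrange π t r) (begin
  ∑ (λ j → onSuc 0 (r (π ⟨$⟩ʳ j)) λ x → placements t ((r ∘ (π ⟨$⟩ʳ_)) [ j ]≔ x))
    ≡⟨ sum-cong-≗ (λ j → onSuc-cong 0 (r (π ⟨$⟩ʳ j)) λ x →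
         trans (placements-cong t (≔-rearrange π r j x)) (placements-rearrange π t (r [ π ⟨$⟩ʳ j ]≔ x))) ⟩
  ∑ (λ j → h (π ⟨$⟩ʳ j))
    ≡⟨ sum-permute h π ⟨
  ∑ h ∎)
  where
  open ≡-Reasoning
  h = λ j → onSuc 0 (r j) λ x → placements t (r [ j ]≔ x)

placements-allBut : ∀ t m (i : Fin (suc k)) → placements t (const m [ i ]≔ 0) ≡ placements t (const m [ zero ]≔ 0)
placements-allBut t m i = begin
  placements t (const m [ i ]≔ 0)            ≡⟨ placements-cong t (≔-rearrange π (const m) i 0) ⟩
  placements t ((const m [ σ i ]≔ 0) ∘ σ)    ≡⟨ placements-rearrange π t _ ⟩
  placements t (const m [ σ i ]≔ 0)          ≡⟨ cong (λ j → placements t (const m [ j ]≔ 0)) σi≡0 ⟩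
  placements t (const m [ zero ]≔ 0)         ∎
  where
  open ≡-Reasoning
  π = transpose i zero
  σ = π ⟨$⟩ʳ_
  σi≡0 : σ i ≡ zero
  σi≡0 = PermutationComponents.transpose-inverse i zero

twoColourings-pos : ∀ s a b → a + b ≡ s → 0 < twoColourings s a b
twoColourings-pos zero    a       b       a+b≡0 rewrite a+b≡0 = s≤s z≤n
twoColourings-pos (suc s) zero    zero    ()
twoColourings-pos (suc s) zero    (suc b) a+b≡1+s = twoColourings-pos s zero b (suc-injective a+b≡1+s)
twoColourings-pos (suc s) (suc a) b       a+b≡1+s =
  ≤-trans (twoColourings-pos s a b (suc-injective a+b≡1+s)) (m≤m+n _ _)

placements-suc-≥ : ∀ t (r : Fin k → ℕ) j x → r j ≡ suc x → placements t (r [ j ]≔ x) ≤ placements (suc t) r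
placements-suc-≥ t r j x rj≡1+x = begin
  placements t (r [ j ]≔ x)  ≡⟨ cong (λ a → onSuc 0 a λ x → placements t (r [ j ]≔ x)) rj≡1+x ⟨
  h j                        ≤⟨ ∑-term h j ⟩
  ∑ h                        ≤⟨ m≤n+m (∑ h) _ ⟩
  placements (suc t) r       ∎
  where
  open ≤-Reasoning
  h = λ j → onSuc 0 (r j) λ x → placements t (r [ j ]≔ x)

placements-pos : ∀ t (r : Fin k → ℕ) → ∑ r ≤ t → 0 < placements t r
placements-pos zero    r ∑r≤0 rewrite n≤0⇒n≡0 ∑r≤0 = s≤s z≤n
placements-pos {k} (suc t) r ∑r≤1+t with all? (λ j → r j ≟ℕ 0)
... | yes r≗0 = ≤-trans (placements-pos t r ∑r≤t) (m≤m+n _ _)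
  where
  ∑r≤t : ∑ r ≤ t
  ∑r≤t = subst (_≤ t) (sym (trans (sum-cong-≗ r≗0) (sum-replicate-zero k))) z≤n
... | no r≉0 with ¬∀⟶∃¬ _ _ (λ j → r j ≟ℕ 0) r≉0
...   | j , rj≢0 = <-≤-trans (placements-pos t (r [ j ]≔ x) ∑r'≤t) (placements-suc-≥ t r j x rj≡1+x)
  where
  x = pred (r j)
  rj≡1+x : r j ≡ suc x
  rj≡1+x = sym (suc-pred (r j) {{≢-nonZero rj≢0}})
  ∑r'≤t : ∑ (r [ j ]≔ x) ≤ t
  ∑r'≤t = ≤-pred (≤-trans (≤-reflexive (∑-decrement r j rj≡1+x)) ∑r≤1+t)

_≟ₛ_ : DecidableEquality (Subset n)
_≟ₛ_ = ≡-dec Bool._≟_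

δ : Subset n → Subset n → ℕ
δ p q = if does (p ≟ₛ q) then 1 else 0

degree : Fin k → Subset n → ℕ → (Fin k → ℕ) → ℕ
degree {n = n} i S c r = ∑[ v ∈ configurations n c r ] δ (petalSet i v) S

DegreeFormula : Fin k → Subset n → Set
DegreeFormula i S =
  ∀ c r → degree i S c r ≡ twoColourings (∣ S ∣) c (r i) * placements (∣ ∁ S ∣) (r [ i ]≔ 0)

degree-[] : ∀ (i : Fin k) → DegreeFormula i []
degree-[] i c r = begin
  degree i [] c r
    ≡⟨ sumOver-replicate (zeroIndicator (c + ∑ r)) Vec.[] (λ v → δ (petalSet i v) []) ⟩
  zeroIndicator (c + ∑ r) * 1                         ≡⟨ *-identityʳ _ ⟩
  zeroIndicator (c + ∑ r)                             ≡⟨ cong (λ a → zeroIndicator (c + a)) (∑-updateAt r i 0) ⟨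
  zeroIndicator (c + (r i + ∑ (r [ i ]≔ 0)))          ≡⟨ cong zeroIndicator (+-assoc c (r i) _) ⟨
  zeroIndicator (c + r i + ∑ (r [ i ]≔ 0))            ≡⟨ zeroIndicator-+ (c + r i) _ ⟩
  twoColourings 0 c (r i) * placements 0 (r [ i ]≔ 0) ∎
  where open ≡-Reasoning

degree-outside∷ : ∀ {i : Fin k} {S : Subset n} → DegreeFormula i S → DegreeFormula i (outside ∷ S)
degree-outside∷ {n = n} {i = i} {S} IH c r = begin
  degree i (outside ∷ S) c r
    ≡⟨ sumOver-configurations n c r _ ⟩
  degree i S c r + (onSuc 0 c (λ c' → ∑[ v ∈ configurations n c' r ] 0) + ∑ petalTerm)
    ≡⟨ cong₂ _+_ (IH c r) (cong₂ _+_ noCore (sum-cong-≗ petalTerm≡)) ⟩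
  T * P + ∑ (λ j → T * h j)
    ≡⟨ cong (T * P +_) (*-distribˡ-sum T h) ⟨
  T * P + T * ∑ h
    ≡⟨ *-distribˡ-+ T P (∑ h) ⟨
  T * placements (suc ∣ ∁ S ∣) r' ∎
  where
  open ≡-Reasoning
  T = twoColourings (∣ S ∣) c (r i)
  r' = r [ i ]≔ 0
  P = placements (∣ ∁ S ∣) r'
  h′ = λ j x → placements (∣ ∁ S ∣) (r' [ j ]≔ x)
  h = λ j → onSuc 0 (r' j) (h′ j)
  petalTerm = λ j → onSuc 0 (r j) λ x →
    ∑[ v ∈ configurations n c (r [ j ]≔ x) ] δ (petalSet i (petal j ∷ v)) (outside ∷ S)
  noCore : onSuc 0 c (λ c' → ∑[ v ∈ configurations n c' r ] 0) ≡ 0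
  noCore = trans (onSuc-cong 0 c (sumOver-zero ∘ λ c' → configurations n c' r)) (onSuc-const 0 c)
  petalTerm≡ : ∀ j → petalTerm j ≡ T * h j
  petalTerm≡ j with i ≟ j
  ... | yes refl = begin
    onSuc 0 (r i) (λ x → ∑[ v ∈ configurations n c (r [ i ]≔ x) ] 0)
      ≡⟨ onSuc-cong 0 (r i) (sumOver-zero ∘ λ x → configurations n c (r [ i ]≔ x)) ⟩
    onSuc 0 (r i) (const 0) ≡⟨ onSuc-const 0 (r i) ⟩
    0                       ≡⟨ *-zeroʳ T ⟨
    T * 0                   ≡⟨ cong (λ a → T * onSuc 0 a (h′ i)) (updateAt-updates i r) ⟨
    T * h i                 ∎
  ... | no i≢j = begin
    onSuc 0 (r j) (λ x → degree i S c (r [ j ]≔ x))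
      ≡⟨ onSuc-cong 0 (r j) (λ x → trans (IH c (r [ j ]≔ x))
           (cong₂ _*_ (cong (twoColourings (∣ S ∣) c) (updateAt-minimal i j r i≢j))
                      (placements-cong (∣ ∁ S ∣) (updateAt-commutes i j i≢j r)))) ⟩
    onSuc 0 (r j) (λ x → T * placements (∣ ∁ S ∣) (r' [ j ]≔ x))
      ≡⟨ onSuc-natural (T *_) (r j) _ (*-zeroʳ T) ⟨
    T * onSuc 0 (r j) (λ x → placements (∣ ∁ S ∣) (r' [ j ]≔ x))
      ≡⟨ cong (λ a → T * onSuc 0 a (h′ j)) (updateAt-minimal j i r (i≢j ∘ sym)) ⟨
    T * h j ∎

degree-inside∷ : ∀ {i : Fin k} {S : Subset n} → DegreeFormula i S → DegreeFormula i (inside ∷ S)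
degree-inside∷ {n = n} {i = i} {S} IH c r = begin
  degree i (inside ∷ S) c r
    ≡⟨ sumOver-configurations n c r _ ⟩
  ∑[ v ∈ configurations n c r ] 0 + (onSuc 0 c (λ c' → degree i S c' r) + ∑ petalTerm)
    ≡⟨ cong₂ _+_ (sumOver-zero (configurations n c r))
         (cong₂ _+_ (onSuc-cong 0 c λ c' → IH c' r) (∑-single petalTerm i offPetal)) ⟩
  onSuc 0 c (λ a → twoColourings (∣ S ∣) a (r i) * P) + petalTerm i
    ≡⟨ cong₂ _+_ (onSuc-natural (_* P) c _ refl) onPetal ⟨
  onSuc 0 c (λ a → twoColourings (∣ S ∣) a (r i)) * P + onSuc 0 (r i) (twoColourings (∣ S ∣) c) * P
    ≡⟨ *-distribʳ-+ P (onSuc 0 c λ a → twoColourings (∣ S ∣) a (r i)) (onSuc 0 (r i) (twoColourings (∣ S ∣) c)) ⟨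
  twoColourings (suc ∣ S ∣) c (r i) * P ∎
  where
  open ≡-Reasoning
  r' = r [ i ]≔ 0
  P = placements (∣ ∁ S ∣) r'
  petalTerm = λ j → onSuc 0 (r j) λ x →
    ∑[ v ∈ configurations n c (r [ j ]≔ x) ] δ (petalSet i (petal j ∷ v)) (inside ∷ S)
  offPetal : ∀ j → j ≢ i → petalTerm j ≡ 0
  offPetal j j≢i with i ≟ j
  ... | yes refl = contradiction refl j≢i
  ... | no _ = trans (onSuc-cong 0 (r j) (sumOver-zero ∘ λ x → configurations n c (r [ j ]≔ x))) (onSuc-const 0 (r j))
  onPetal : onSuc 0 (r i) (twoColourings (∣ S ∣) c) * P ≡ petalTerm i
  onPetal rewrite dec-true (i ≟ i) refl = begin
    onSuc 0 (r i) (twoColourings (∣ S ∣) c) * P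
      ≡⟨ onSuc-natural (_* P) (r i) _ refl ⟩
    onSuc 0 (r i) (λ x → twoColourings (∣ S ∣) c x * P)
      ≡⟨ onSuc-cong 0 (r i) (λ x → sym (trans (IH c (r [ i ]≔ x))
           (cong₂ _*_ (cong (twoColourings (∣ S ∣) c) (updateAt-updates i r))
                      (placements-cong (∣ ∁ S ∣) (updateAt-updateAt i r))))) ⟩
    onSuc 0 (r i) (λ x → degree i S c (r [ i ]≔ x)) ∎

-- Petal i of a configuration is S iff it labels S by core and petal i only, and the
-- complement of S by blanks and the other petals.
degree-formula : ∀ (i : Fin k) (S : Subset n) → DegreeFormula i S
degree-formula i []            = degree-[] i
degree-formula i (outside ∷ S) = degree-outside∷ {i = i} {S} (degree-formula i S)
degree-formula i (inside ∷ S)  = degree-inside∷ {i = i} {S} (degree-formula i S)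

subsetsOfSize : ∀ n → ℕ → List (Subset n)
subsetsOfSize zero    zero    = [ [] ]
subsetsOfSize zero    (suc s) = []
subsetsOfSize (suc n) zero    = map (outside ∷_) (subsetsOfSize n zero)
subsetsOfSize (suc n) (suc s) = map (outside ∷_) (subsetsOfSize n (suc s)) ++ map (inside ∷_) (subsetsOfSize n s)

subsetsOfSize-size : ∀ n s → All (λ p → ∣ p ∣ ≡ s) (subsetsOfSize n s)
subsetsOfSize-size zero    zero    = refl ∷ []
subsetsOfSize-size zero    (suc s) = []
subsetsOfSize-size (suc n) zero    = All.map⁺ (subsetsOfSize-size n zero)
subsetsOfSize-size (suc n) (suc s) =
  All.++⁺ (All.map⁺ (subsetsOfSize-size n (suc s))) (All.map⁺ (All.map (cong suc) (subsetsOfSize-size n s)))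

∈-subsetsOfSize : ∀ (p : Subset n) → p ∈ subsetsOfSize n ∣ p ∣
∈-subsetsOfSize []            = here refl
∈-subsetsOfSize (inside ∷ p)  = ∈-++⁺ʳ _ (∈-map⁺ (inside ∷_) (∈-subsetsOfSize p))
∈-subsetsOfSize (outside ∷ p) with ∣ p ∣ | ∈-subsetsOfSize p
... | zero  | p∈ = ∈-map⁺ (outside ∷_) p∈
... | suc _ | p∈ = ∈-++⁺ˡ (∈-map⁺ (outside ∷_) p∈)

subsetsOfSize-unique : ∀ n s → Unique (subsetsOfSize n s)
subsetsOfSize-unique zero    zero    = [] ∷ []
subsetsOfSize-unique zero    (suc s) = []
subsetsOfSize-unique (suc n) zero    = Unique.map⁺ ∷-injectiveʳ (subsetsOfSize-unique n zero)
subsetsOfSize-unique (suc n) (suc s) =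
  Unique.++⁺ (Unique.map⁺ ∷-injectiveʳ (subsetsOfSize-unique n (suc s)))
             (Unique.map⁺ ∷-injectiveʳ (subsetsOfSize-unique n s)) disjoint
  where
  disjoint : ∀ {p} → ¬ (p ∈ map (outside ∷_) (subsetsOfSize n (suc s)) × p ∈ map (inside ∷_) (subsetsOfSize n s))
  disjoint (p∈outs , p∈ins) with ∈-map⁻ (outside ∷_) p∈outs | ∈-map⁻ (inside ∷_) p∈ins
  ... | _ , _ , refl | _ , _ , ()

length-subsetsOfSize : ∀ n s → length (subsetsOfSize n s) ≡ n C s
length-subsetsOfSize zero    zero    = refl
length-subsetsOfSize zero    (suc s) = refl
length-subsetsOfSize (suc n) zero    =
  trans (length-map (outside ∷_) (subsetsOfSize n zero)) (length-subsetsOfSize n zero)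
length-subsetsOfSize (suc n) (suc s) = begin
  length (outs ++ ins)                  ≡⟨ length-++ outs ⟩
  length outs + length ins
    ≡⟨ cong₂ _+_ (length-map _ (subsetsOfSize n (suc s))) (length-map _ (subsetsOfSize n s)) ⟩
  length (subsetsOfSize n (suc s)) + length (subsetsOfSize n s)
                                        ≡⟨ cong₂ _+_ (length-subsetsOfSize n (suc s)) (length-subsetsOfSize n s) ⟩
  n C suc s + n C s                     ≡⟨ +-comm (n C suc s) (n C s) ⟩
  n C s + n C suc s                     ≡⟨ nCk+nC[k+1]≡[n+1]C[k+1] n s ⟩
  suc n C suc s                         ∎
  where
  open ≡-Reasoning
  outs = map (outside ∷_) (subsetsOfSize n (suc s))
  ins = map (inside ∷_) (subsetsOfSize n s)

occurrences : Subset n → List (Subset n) → ℕ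
occurrences p qs = ∑[ q ∈ qs ] δ p q

occurrences-∉ : ∀ (p : Subset n) {qs} → All (p ≢_) qs → occurrences p qs ≡ 0
occurrences-∉ p {[]}     []           = refl
occurrences-∉ p {q ∷ qs} (p≢q ∷ p∉qs) with p ≟ₛ q
... | yes p≡q = contradiction p≡q p≢q
... | no _    = occurrences-∉ p p∉qs

occurrences≤1 : ∀ (p : Subset n) {qs} → Unique qs → occurrences p qs ≤ 1
occurrences≤1 p {[]}     []             = z≤n
occurrences≤1 p {q ∷ qs} (q∉qs ∷ unique) with p ≟ₛ q
... | yes refl = ≤-reflexive (cong suc (occurrences-∉ p q∉qs))
... | no _     = occurrences≤1 p unique

∈⇒1≤occurrences : ∀ {p : Subset n} {qs} → p ∈ qs → 1 ≤ occurrences p qs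
∈⇒1≤occurrences {p = p} (here refl) rewrite dec-true (p ≟ₛ p) refl = s≤s z≤n
∈⇒1≤occurrences (there p∈qs) = ≤-trans (∈⇒1≤occurrences p∈qs) (m≤n+m _ _)

1≤occurrences⇒∈ : ∀ (p : Subset n) qs → 1 ≤ occurrences p qs → p ∈ qs
1≤occurrences⇒∈ p (q ∷ qs) 1≤occ with p ≟ₛ q
... | yes p≡q = here p≡q
... | no _    = there (1≤occurrences⇒∈ p qs 1≤occ)

-- Sunflower-free families

shape⇒sunflower : ∀ {s c} {r : Fin k → ℕ} {v : Vec (Label k) n} (𝒜 : Fin k → Family n s) →
  SunflowerShape c r v → (∀ i → 0 < r i) → (∀ i → petalSet i v ∈ members (𝒜 i)) → MulticolorSunflower 𝒜 c
shape⇒sunflower {v = v} 𝒜 shape 0<r petals∈ = record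
  { petal    = λ i → petalSet i v
  ; petal∈   = petals∈
  ; core     = coreSet v
  ; pairwise = λ i j i≢j → petalSet-∩ i≢j v
  ; nonempty = λ i → SunflowerShape.petal⊈core shape i (0<r i)
  ; coreSize = SunflowerShape.core-size shape
  }

sunflowerFree⇒∑occurrences≤ : ∀ {s c} {r : Fin (suc k) → ℕ} {v : Vec (Label (suc k)) n}
  (𝒜 : Fin (suc k) → Family n s) → SunflowerFree 𝒜 c → SunflowerShape c r v → (∀ i → 0 < r i) →
  ∑ (λ i → occurrences (petalSet i v) (members (𝒜 i))) ≤ k
sunflowerFree⇒∑occurrences≤ {v = v} 𝒜 free shape 0<r =
  ∑-≤-pred _ (λ i → occurrences≤1 (petalSet i v) (distinct (𝒜 i))) λ 1≤occ →
    free (shape⇒sunflower 𝒜 shape 0<r λ i → 1≤occurrences⇒∈ (petalSet i v) (members (𝒜 i)) (1≤occ i))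

sumOver-occurrences : ∀ {s D} (i : Fin k) c r (qs : List (Subset n)) → All (λ S → ∣ S ∣ ≡ s) qs →
  (∀ (S : Subset n) → ∣ S ∣ ≡ s → degree i S c r ≡ D) →
  ∑[ v ∈ configurations n c r ] occurrences (petalSet i v) qs ≡ length qs * D
sumOver-occurrences {n = n} {D = D} i c r qs uniform regular = begin
  ∑[ v ∈ configurations n c r ] ∑[ S ∈ qs ] δ (petalSet i v) S  ≡⟨ sumOver-comm (configurations n c r) qs _ ⟩
  ∑[ S ∈ qs ] degree i S c r                                     ≡⟨ sumOver-congᴬ uniform (λ {S} → regular S) ⟩
  ∑[ S ∈ qs ] D                                                  ≡⟨ sumOver-const qs D ⟩
  length qs * D                                                  ∎
  where open ≡-Reasoning

module _ (k s c n : ℕ) (c<s : c < s) (c+[1+k][s∸c]≤n : c + suc k * (s ∸ c) ≤ n) where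

  private
    m = s ∸ c
    r : Fin (suc k) → ℕ
    r = const m
    V = configurations n c r
    shapes = configurations-shape n c r

    c+m≡s : c + m ≡ s
    c+m≡s = m+[n∸m]≡n (<⇒≤ c<s)

    km≤n∸s : k * m ≤ n ∸ s
    km≤n∸s = m+n≤o⇒m≤o∸n (k * m) (begin
      k * m + s          ≡⟨ +-comm (k * m) s ⟩
      s + k * m          ≡⟨ cong (_+ k * m) c+m≡s ⟨
      c + m + k * m      ≡⟨ +-assoc c m (k * m) ⟩
      c + suc k * m      ≤⟨ c+[1+k][s∸c]≤n ⟩
      n                  ∎)
      where open ≤-Reasoning

  petalDegree : ℕ
  petalDegree = twoColourings s c m * placements (n ∸ s) (r [ zero ]≔ 0)

  petalDegree-pos : 0 < petalDegree
  petalDegree-pos = *-mono-< (twoColourings-pos s c m c+m≡s)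
                             (placements-pos (n ∸ s) _ (≤-trans (≤-reflexive (∑-const k m)) km≤n∸s))

  degree-regular : ∀ i (S : Subset n) → ∣ S ∣ ≡ s → degree i S c r ≡ petalDegree
  degree-regular i S ∣S∣≡s = begin
    degree i S c r
      ≡⟨ degree-formula i S c r ⟩
    twoColourings (∣ S ∣) c m * placements (∣ ∁ S ∣) (r [ i ]≔ 0)
      ≡⟨ cong₂ (λ a b → twoColourings a c m * placements b (r [ i ]≔ 0))
               ∣S∣≡s (trans (∣∁p∣≡n∸∣p∣ S) (cong (n ∸_) ∣S∣≡s)) ⟩
    twoColourings s c m * placements (n ∸ s) (r [ i ]≔ 0)
      ≡⟨ cong (twoColourings s c m *_) (placements-allBut (n ∸ s) m i) ⟩
    petalDegree ∎
    where open ≡-Reasoning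

  length-configurations : length V ≡ (n C s) * petalDegree
  length-configurations = begin
    length V                                                      ≡⟨ *-identityʳ (length V) ⟨
    length V * 1                                                  ≡⟨ sumOver-const V 1 ⟨
    ∑[ v ∈ V ] 1                                                  ≡⟨ sumOver-congᴬ shapes occurs-once ⟨
    ∑[ v ∈ V ] occurrences (petalSet zero v) (subsetsOfSize n s)  ≡⟨ sumOver-occurrences zero c r (subsetsOfSize n s)
                                                                        (subsetsOfSize-size n s) (degree-regular zero) ⟩
    length (subsetsOfSize n s) * petalDegree                      ≡⟨ cong (_* petalDegree) (length-subsetsOfSize n s) ⟩
    (n C s) * petalDegree                                         ∎
    where
    open ≡-Reasoning
    occurs-once : ∀ {v} → SunflowerShape c r v → occurrences (petalSet zero v) (subsetsOfSize n s) ≡ 1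
    occurs-once {v} shape = ≤-antisym (occurrences≤1 (petalSet zero v) (subsetsOfSize-unique n s))
      (∈⇒1≤occurrences (subst (λ a → petalSet zero v ∈ subsetsOfSize n a)
                              (trans (SunflowerShape.petal-size shape zero) c+m≡s)
                              (∈-subsetsOfSize (petalSet zero v))))

  sunflowerFree⇒totalSize≤ : (𝒜 : Fin (suc k) → Family n s) → SunflowerFree 𝒜 c → totalSize 𝒜 ≤ k * (n C s)
  sunflowerFree⇒totalSize≤ 𝒜 free =
    *-cancelʳ-≤ (totalSize 𝒜) (k * (n C s)) D {{>-nonZero petalDegree-pos}} (begin
    totalSize 𝒜 * D                          ≡⟨ cong (_* D) (sum-tabulate (λ i → size (𝒜 i))) ⟩
    ∑ (λ i → size (𝒜 i)) * D                 ≡⟨ *-distribʳ-sum D (λ i → size (𝒜 i)) ⟩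
    ∑ (λ i → size (𝒜 i) * D)                 ≡⟨ sum-cong-≗ incidences ⟨
    ∑ (λ i → ∑[ v ∈ V ] occurrences′ i v)    ≡⟨ sumOver-∑ V occurrences′ ⟨
    ∑[ v ∈ V ] ∑ (λ i → occurrences′ i v)    ≤⟨ sumOver-monoᴬ shapes
                                                  (λ shape → sunflowerFree⇒∑occurrences≤ 𝒜 free shape (const 0<m)) ⟩
    ∑[ v ∈ V ] k                             ≡⟨ sumOver-const V k ⟩
    length V * k                             ≡⟨ cong (_* k) length-configurations ⟩
    (n C s) * D * k                          ≡⟨ *-comm ((n C s) * D) k ⟩
    k * ((n C s) * D)                        ≡⟨ *-assoc k (n C s) D ⟨
    k * (n C s) * D                          ∎)
    where
    open ≤-Reasoning
    D = petalDegree
    occurrences′ = λ i v → occurrences (petalSet i v) (members (𝒜 i))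
    incidences : ∀ i → ∑[ v ∈ V ] occurrences′ i v ≡ size (𝒜 i) * D
    incidences i = sumOver-occurrences i c r (members (𝒜 i)) (uniform (𝒜 i)) (degree-regular i)
    0<m : 0 < m
    0<m = m<n⇒0<n∸m c<s

emptyFamily : ∀ {n s} → Family n s
emptyFamily = record { members = [] ; distinct = [] ; uniform = [] }

completeFamily : ∀ n s → Family n s
completeFamily n s = record
  { members = subsetsOfSize n s ; distinct = subsetsOfSize-unique n s ; uniform = subsetsOfSize-size n s }

extremal : ∀ k n s → Fin (suc k) → Family n s
extremal k n s zero    = emptyFamily
extremal k n s (suc _) = completeFamily n s

extremal-sunflowerFree : ∀ k n s c → SunflowerFree (extremal k n s) c
extremal-sunflowerFree k n s c sunflower with MulticolorSunflower.petal∈ sunflower zero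
... | ()

totalSize-extremal : ∀ k n s → totalSize (extremal k n s) ≡ k * (n C s)
totalSize-extremal k n s =
  trans (sum-tabulate (size ∘ extremal k n s))
        (trans (∑-const k (length (subsetsOfSize n s))) (cong (k *_) (length-subsetsOfSize n s)))

lemma1 : (k s c n : ℕ) → 2 ≤ k → 1 ≤ s → c < s → c + k * (s ∸ c) ≤ n →
    ((𝒜 : Fin k → Family n s) → SunflowerFree 𝒜 c →
      totalSize 𝒜 ≤ (k ∸ 1) * (n C s))
    × Σ (Fin k → Family n s) (λ 𝒜 → SunflowerFree 𝒜 c × totalSize 𝒜 ≡ (k ∸ 1) * (n C s))
lemma1 (suc k) s c n _ _ c<s c+k[s∸c]≤n =
    sunflowerFree⇒totalSize≤ k s c n c<s c+k[s∸c]≤n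
  , extremal k n s , extremal-sunflowerFree k n s c , totalSize-extremal k n s
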